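{- Let $\mathcal D$ be a $\Sigma$-structure and $\psi$ a closed $\Sigma(\Pi)$-aggregate formula, possibly containing domain elements as constants. For all interpretations $I\subseteq J\subseteq base_{\mathcal D}(\Pi)$: if $\psi$ is positive then $\mathcal D(I)\models\psi$ implies $\mathcal D(J)\models\psi$; if $\psi$ is negative then $\mathcal D(J)\models\psi$ implies $\mathcal D(I)\models\psi$.
   Context: An aggregate relation $R\subseteq\mathcal P(D_1)\times D_2$ is monotone if $(S_1,d)\in R$, $S_1\subseteq S_2$ imply $(S_2,d)\in R$, and anti-monotone if $(S_2,d)\in R$, $S_1\subseteq S_2$ imply $(S_1,d)\in R$. An aggregate signature $\Sigma$ has sorts, sorted function, predicate and aggregate symbols $\mathsf R:\{s_1\times\dots\times s_n\}\times w$; set expressions $\{(x_1,\dots,x_n)\mid\varphi\}$, aggregate atoms $\mathsf R(s,t)$ and aggregate formulas (closed under $\neg,\wedge,\vee,\forall,\exists$) are defined simultaneously; a $\Sigma$-structure interprets aggregate symbols by aggregate relations, a set expression $\{\bar x\mid\varphi(\bar x)\}$ by $\{\bar d\mid\varphi(\bar d)\text{ holds}\}$, and $\mathsf R(s,t)$ holds iff (value of $s$, value of $t$)$\in\mathsf R^{\mathcal D}$. $\Pi$ is a set of predicate symbols not in $\Sigma$; $base_{\mathcal D}(\Pi)$ is the set of ground $\Pi$-atoms over domain elements; $\mathcal D(I)$ is the $\Sigma(\Pi)$-structure extending $\mathcal D$ in which exactly the atoms of $I$ are true. An occurrence of a predicate in a formula is neutral if it lies inside the condition $\theta$ of an aggregate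 atom $\mathsf R(\{\bar x\mid\theta\},t)$ with $\mathsf R^{\mathcal D}$ neither monotone nor anti-monotone; otherwise it is positive (resp. negative) if the number of negations and aggregate atoms interpreted by anti-monotone aggregate relations above it is even (resp. odd). A formula is positive if no predicate of $\Pi$ occurs negatively or neutrally in it, and negative if no predicate of $\Pi$ occurs positively or neutrally in it. -}

module Defs where

open import Data.List using (List; []; _∷_; _++_)
open import Data.List.Relation.Unary.All using (All; []; _∷_; lookup)
open import Data.List.Membership.Propositional using (_∈_)
open import Data.Product using (_×_; _,_)
open import Data.Sum using (_⊎_)
open import Data.Unit using (⊤)
open import Data.Empty using (⊥)
open import Relation.Nullary using (¬_)
open import Relation.Binary.PropositionalEquality using (_≡_)
open import Function.Bundles using (_⇔_)
open import Level using (Lift)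

Lift⊤ : Set₁
Lift⊤ = Lift _ ⊤

Lift⊥ : Set₁
Lift⊥ = Lift _ ⊥

SetOf : Set → Set₁
SetOf D = D → Set

_⊆_ : {D : Set} → SetOf D → SetOf D → Set
S₁ ⊆ S₂ = ∀ x → S₁ x → S₂ x

AggRel : Set → Set → Set₁
AggRel D₁ D₂ = SetOf D₁ → D₂ → Set

Monotone : {D₁ D₂ : Set} → AggRel D₁ D₂ → Set₁
Monotone R = ∀ S₁ S₂ d → R S₁ d → S₁ ⊆ S₂ → R S₂ d

AntiMonotone : {D₁ D₂ : Set} → AggRel D₁ D₂ → Set₁
AntiMonotone R = ∀ S₁ S₂ d → R S₂ d → S₁ ⊆ S₂ → R S₁ d

-- subsets are predicates, so "the same set" means pointwise equivalence;
-- an aggregate relation must relate sets, i.e. respect this equality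
Extensional : {D₁ D₂ : Set} → AggRel D₁ D₂ → Set₁
Extensional R = ∀ S₁ S₂ d → (∀ x → S₁ x ⇔ S₂ x) → R S₁ d → R S₂ d

record Signature : Set₁ where
  field
    Sort    : Set
    FunSym  : Set
    funArgs : FunSym → List Sort
    funRes  : FunSym → Sort
    PredSym : Set
    predAr  : PredSym → List Sort
    AggSym  : Set
    aggSet  : AggSym → List Sort
    aggRes  : AggSym → Sort

-- the extra predicate symbols Π (disjoint from Σ by construction)
record PredSig (Σ : Signature) : Set₁ where
  open Signature Σ
  field
    PSym : Set
    ar   : PSym → List Sort

module _ (Σ : Signature) where
  open Signature Σ

  record Structure : Set₁ where
    field
      Dom     : Sort → Set
      fun     : (f : FunSym) → All Dom (funArgs f) → Dom (funRes f)
      pred    : (p : PredSym) → All Dom (predAr p) → Set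
      agg     : (a : AggSym) → AggRel (All Dom (aggSet a)) (Dom (aggRes a))
      agg-ext : (a : AggSym) → Extensional (agg a)

-- Syntax of Σ(Π)-aggregate formulas, with domain elements as constants.
-- Variables are de Bruijn indices into a context of sorts.

module Syntax (Σ : Signature) (Π : PredSig Σ) (Dom : Signature.Sort Σ → Set) where
  open Signature Σ
  open PredSig Π

  data Term (Γ : List Sort) : Sort → Set where
    var : ∀ {s} → s ∈ Γ → Term Γ s
    el  : ∀ {s} → Dom s → Term Γ s
    app : (f : FunSym) → All (Term Γ) (funArgs f) → Term Γ (funRes f)

  mutual
    -- set expression {(x₁,…,xₙ) | φ}; x₁ … xₙ are the first n variables of φ
    data SetExpr (Γ : List Sort) (ss : List Sort) : Set where
      setOf : Formula (ss ++ Γ) → SetExpr Γ ss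

    data Formula (Γ : List Sort) : Set where
      σatom : (p : PredSym) → All (Term Γ) (predAr p) → Formula Γ
      πatom : (p : PSym) → All (Term Γ) (ar p) → Formula Γ
      _≐_   : ∀ {s} → Term Γ s → Term Γ s → Formula Γ
      ¬'_   : Formula Γ → Formula Γ
      _∧'_  : Formula Γ → Formula Γ → Formula Γ
      _∨'_  : Formula Γ → Formula Γ → Formula Γ
      ∀'    : (s : Sort) → Formula (s ∷ Γ) → Formula Γ
      ∃'    : (s : Sort) → Formula (s ∷ Γ) → Formula Γ
      aggAt : (a : AggSym) → SetExpr Γ (aggSet a) → Term Γ (aggRes a) → Formula Γ

_+++_ : {A : Set} {P : A → Set} {xs ys : List A} → All P xs → All P ys → All P (xs ++ ys)
[]       +++ bs = bs
(a ∷ as) +++ bs = a ∷ (as +++ bs)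

module Semantics (Σ : Signature) (Π : PredSig Σ) (D : Structure Σ) where
  open Signature Σ
  open PredSig Π
  open Structure D
  open Syntax Σ Π Dom public

  Interp : Set₁
  Interp = (p : PSym) → All Dom (ar p) → Set

  _⊆I_ : Interp → Interp → Set
  I ⊆I J = ∀ p ds → I p ds → J p ds

  Env : List Sort → Set
  Env Γ = All Dom Γ

  mutual
    evalT : ∀ {Γ s} → Term Γ s → Env Γ → Dom s
    evalT (var x)    ρ = lookup ρ x
    evalT (el d)     ρ = d
    evalT (app f ts) ρ = fun f (evalTs ts ρ)

    evalTs : ∀ {Γ ss} → All (Term Γ) ss → Env Γ → All Dom ss
    evalTs []       ρ = []
    evalTs (t ∷ ts) ρ = evalT t ρ ∷ evalTs ts ρ

  mutual
    ⟦_⟧S : ∀ {Γ ss} → SetExpr Γ ss → Interp → Env Γ → SetOf (All Dom ss)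
    ⟦ setOf φ ⟧S I ρ = λ ds → ⟦ φ ⟧ I (ds +++ ρ)

    ⟦_⟧ : ∀ {Γ} → Formula Γ → Interp → Env Γ → Set
    ⟦ σatom p ts ⟧  I ρ = pred p (evalTs ts ρ)
    ⟦ πatom p ts ⟧  I ρ = I p (evalTs ts ρ)
    ⟦ t ≐ u ⟧       I ρ = evalT t ρ ≡ evalT u ρ
    ⟦ ¬' φ ⟧        I ρ = ¬ ⟦ φ ⟧ I ρ
    ⟦ φ ∧' ψ ⟧      I ρ = ⟦ φ ⟧ I ρ × ⟦ ψ ⟧ I ρ
    ⟦ φ ∨' ψ ⟧      I ρ = ⟦ φ ⟧ I ρ ⊎ ⟦ ψ ⟧ I ρ
    ⟦ ∀' s φ ⟧      I ρ = (d : Dom s) → ⟦ φ ⟧ I (d ∷ ρ)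
    ⟦ ∃' s φ ⟧      I ρ = Data.Product.Σ (Dom s) (λ d → ⟦ φ ⟧ I (d ∷ ρ))
    ⟦ aggAt a S t ⟧ I ρ = agg a (⟦ S ⟧S I ρ) (evalT t ρ)

  _⊨_ : Interp → Formula [] → Set
  I ⊨ ψ = ⟦ ψ ⟧ I []

  mutual
    NoΠ : ∀ {Γ} → Formula Γ → Set₁
    NoΠ (σatom p ts) = Lift⊤
    NoΠ (πatom p ts) = Lift⊥
    NoΠ (t ≐ u)      = Lift⊤
    NoΠ (¬' φ)       = NoΠ φ
    NoΠ (φ ∧' ψ)     = NoΠ φ × NoΠ ψ
    NoΠ (φ ∨' ψ)     = NoΠ φ × NoΠ ψ
    NoΠ (∀' s φ)     = NoΠ φ
    NoΠ (∃' s φ)     = NoΠ φ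
    NoΠ (aggAt a (setOf θ) t) = NoΠ θ

    Positive : ∀ {Γ} → Formula Γ → Set₁
    Positive (σatom p ts) = Lift⊤
    Positive (πatom p ts) = Lift⊤
    Positive (t ≐ u)      = Lift⊤
    Positive (¬' φ)       = Negative φ
    Positive (φ ∧' ψ)     = Positive φ × Positive ψ
    Positive (φ ∨' ψ)     = Positive φ × Positive ψ
    Positive (∀' s φ)     = Positive φ
    Positive (∃' s φ)     = Positive φ
    Positive (aggAt a (setOf θ) t) =
        ((¬ Monotone (agg a)) × (¬ AntiMonotone (agg a)) × NoΠ θ)
      ⊎ (AntiMonotone (agg a) × Negative θ)
      ⊎ (Monotone (agg a) × (¬ AntiMonotone (agg a)) × Positive θ)

    Negative : ∀ {Γ} → Formula Γ → Set₁
    Negative (σatom p ts) = Lift⊤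
    Negative (πatom p ts) = Lift⊥
    Negative (t ≐ u)      = Lift⊤
    Negative (¬' φ)       = Positive φ
    Negative (φ ∧' ψ)     = Negative φ × Negative ψ
    Negative (φ ∨' ψ)     = Negative φ × Negative ψ
    Negative (∀' s φ)     = Negative φ
    Negative (∃' s φ)     = Negative φ
    Negative (aggAt a (setOf θ) t) =
        ((¬ Monotone (agg a)) × (¬ AntiMonotone (agg a)) × NoΠ θ)
      ⊎ (AntiMonotone (agg a) × Positive θ)
      ⊎ (Monotone (agg a) × (¬ AntiMonotone (agg a)) × Negative θ)

-- By simultaneous induction on the formula, positive formulas are preserved
-- and negative ones reflected along I ⊆ J: a negation swaps the two claims,
-- and so does the condition of an anti-monotone aggregate atom.  A neutral
-- condition contains no Π-atom, so it denotes the same set under I and J up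
-- to pointwise equivalence, which the extensionality of aggregate relations
-- absorbs.
module Submission where

open import Defs
open import Data.List using ([])
open import Data.List.Relation.Unary.All using (_∷_) renaming ([] to []ᴬ)
open import Data.Product using (_×_; _,_)
open import Data.Sum using (inj₁; inj₂)
open import Function.Bundles using (mk⇔)

module Monotonicity (Σ : Signature) (Π : PredSig Σ) (D : Structure Σ) where
  open Structure D
  open Semantics Σ Π D

  NoΠ⇒invariant : ∀ {Γ} (φ : Formula Γ) (I J : Interp) (ρ : Env Γ) →
                  NoΠ φ → ⟦ φ ⟧ I ρ → ⟦ φ ⟧ J ρ
  NoΠ⇒invariant (σatom p ts) I J ρ _ x = x
  NoΠ⇒invariant (πatom p ts) I J ρ () x
  NoΠ⇒invariant (t ≐ u)      I J ρ _ x = x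
  NoΠ⇒invariant (¬' φ)       I J ρ h x y = x (NoΠ⇒invariant φ J I ρ h y)
  NoΠ⇒invariant (φ ∧' ψ)     I J ρ (h , k) (x , y) =
    NoΠ⇒invariant φ I J ρ h x , NoΠ⇒invariant ψ I J ρ k y
  NoΠ⇒invariant (φ ∨' ψ)     I J ρ (h , k) (inj₁ x) = inj₁ (NoΠ⇒invariant φ I J ρ h x)
  NoΠ⇒invariant (φ ∨' ψ)     I J ρ (h , k) (inj₂ y) = inj₂ (NoΠ⇒invariant ψ I J ρ k y)
  NoΠ⇒invariant (∀' s φ)     I J ρ h x d = NoΠ⇒invariant φ I J (d ∷ ρ) h (x d)
  NoΠ⇒invariant (∃' s φ)     I J ρ h (d , x) = d , NoΠ⇒invariant φ I J (d ∷ ρ) h x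
  NoΠ⇒invariant (aggAt a (setOf θ) t) I J ρ h x =
    agg-ext a _ _ _ (λ ds → mk⇔ (NoΠ⇒invariant θ I J (ds +++ ρ) h)
                                 (NoΠ⇒invariant θ J I (ds +++ ρ) h)) x

  module _ {I J : Interp} (I⊆J : I ⊆I J) where
    mutual
      Positive⇒monotone : ∀ {Γ} (φ : Formula Γ) (ρ : Env Γ) →
                          Positive φ → ⟦ φ ⟧ I ρ → ⟦ φ ⟧ J ρ
      Positive⇒monotone (σatom p ts) ρ _ x = x
      Positive⇒monotone (πatom p ts) ρ _ x = I⊆J p _ x
      Positive⇒monotone (t ≐ u)      ρ _ x = x
      Positive⇒monotone (¬' φ)       ρ h x y = x (Negative⇒antitone φ ρ h y)
      Positive⇒monotone (φ ∧' ψ)     ρ (h , k) (x , y) =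
        Positive⇒monotone φ ρ h x , Positive⇒monotone ψ ρ k y
      Positive⇒monotone (φ ∨' ψ)     ρ (h , k) (inj₁ x) = inj₁ (Positive⇒monotone φ ρ h x)
      Positive⇒monotone (φ ∨' ψ)     ρ (h , k) (inj₂ y) = inj₂ (Positive⇒monotone ψ ρ k y)
      Positive⇒monotone (∀' s φ)     ρ h x d = Positive⇒monotone φ (d ∷ ρ) h (x d)
      Positive⇒monotone (∃' s φ)     ρ h (d , x) = d , Positive⇒monotone φ (d ∷ ρ) h x
      Positive⇒monotone φ@(aggAt a (setOf θ) t) ρ (inj₁ (_ , _ , h)) x =
        NoΠ⇒invariant φ I J ρ h x
      Positive⇒monotone (aggAt a (setOf θ) t) ρ (inj₂ (inj₁ (anti , h))) x =
        anti _ _ _ x (λ ds → Negative⇒antitone θ (ds +++ ρ) h)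
      Positive⇒monotone (aggAt a (setOf θ) t) ρ (inj₂ (inj₂ (mono , _ , h))) x =
        mono _ _ _ x (λ ds → Positive⇒monotone θ (ds +++ ρ) h)

      Negative⇒antitone : ∀ {Γ} (φ : Formula Γ) (ρ : Env Γ) →
                          Negative φ → ⟦ φ ⟧ J ρ → ⟦ φ ⟧ I ρ
      Negative⇒antitone (σatom p ts) ρ _ x = x
      Negative⇒antitone (πatom p ts) ρ () x
      Negative⇒antitone (t ≐ u)      ρ _ x = x
      Negative⇒antitone (¬' φ)       ρ h x y = x (Positive⇒monotone φ ρ h y)
      Negative⇒antitone (φ ∧' ψ)     ρ (h , k) (x , y) =
        Negative⇒antitone φ ρ h x , Negative⇒antitone ψ ρ k y
      Negative⇒antitone (φ ∨' ψ)     ρ (h , k) (inj₁ x) = inj₁ (Negative⇒antitone φ ρ h x)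
      Negative⇒antitone (φ ∨' ψ)     ρ (h , k) (inj₂ y) = inj₂ (Negative⇒antitone ψ ρ k y)
      Negative⇒antitone (∀' s φ)     ρ h x d = Negative⇒antitone φ (d ∷ ρ) h (x d)
      Negative⇒antitone (∃' s φ)     ρ h (d , x) = d , Negative⇒antitone φ (d ∷ ρ) h x
      Negative⇒antitone φ@(aggAt a (setOf θ) t) ρ (inj₁ (_ , _ , h)) x =
        NoΠ⇒invariant φ J I ρ h x
      Negative⇒antitone (aggAt a (setOf θ) t) ρ (inj₂ (inj₁ (anti , h))) x =
        anti _ _ _ x (λ ds → Positive⇒monotone θ (ds +++ ρ) h)
      Negative⇒antitone (aggAt a (setOf θ) t) ρ (inj₂ (inj₂ (mono , _ , h))) x =
        mono _ _ _ x (λ ds → Negative⇒antitone θ (ds +++ ρ) h)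

proposition8 : (Σ : Signature) (Π : PredSig Σ) (D : Structure Σ)
    → let open Semantics Σ Π D in
      (ψ : Formula []) (I J : Interp) → I ⊆I J
    → (Positive ψ → I ⊨ ψ → J ⊨ ψ) × (Negative ψ → J ⊨ ψ → I ⊨ ψ)
proposition8 Σ Π D ψ I J I⊆J =
  Positive⇒monotone I⊆J ψ []ᴬ , Negative⇒antitone I⊆J ψ []ᴬ
  where open Monotonicity Σ Π D
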